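{- Let $\Gamma$ be any fixed infinite abelian group. Then any algorithm solving Zero Basis for $\Gamma$ requires, in the worst case, a number of independence oracle queries exponential in the size of the ground set.
   Context: Zero Basis: given a matroid $M$ accessed via an independence oracle and a labeling $\psi\colon E(M)\to\Gamma$, find a basis $B$ of $M$ with $\psi(B):=\sum_{e\in B}\psi(e)=0$, or correctly report that none exists. -}

module Defs where

open import Level using (Level; _⊔_)
open import Data.Bool using (Bool; true; false; if_then_else_)
open import Data.Nat using (ℕ; zero; suc; _<_)
open import Data.Fin using (Fin)
import Data.Fin
open import Data.Vec using (Vec; []; _∷_)
open import Data.Fin.Subset using (Subset; ⊥; ⁅_⁆; _∪_; _∈_; _∉_; _⊆_; ∣_∣)
open import Data.Product using (Σ; _×_; ∃)
open import Relation.Binary.PropositionalEquality using (_≡_)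
open import Relation.Nullary using (¬_)
open import Algebra.Bundles using (AbelianGroup)

record Matroid (n : ℕ) : Set where
  field
    indep      : Subset n → Bool
    indep-∅    : indep ⊥ ≡ true
    indep-down : ∀ {I J} → J ⊆ I → indep I ≡ true → indep J ≡ true
    indep-aug  : ∀ {I J} → indep I ≡ true → indep J ≡ true → ∣ I ∣ < ∣ J ∣ →
                 Σ (Fin n) λ e → e ∈ J × e ∉ I × indep (I ∪ ⁅ e ⁆) ≡ true
open Matroid public

IsBasis : ∀ {n} → Matroid n → Subset n → Set
IsBasis {n} M B = indep M B ≡ true × (∀ (e : Fin n) → e ∉ B → indep M (B ∪ ⁅ e ⁆) ≡ false)

module _ {c ℓ : Level} (Γ : AbelianGroup c ℓ) where
  open AbelianGroup Γ renaming (Carrier to G)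

  sumSub : ∀ {n} → (Fin n → G) → Subset n → G
  sumSub {zero}  ψ []      = ε
  sumSub {suc n} ψ (b ∷ B) = (if b then ψ Data.Fin.zero else ε) ∙ sumSub (λ i → ψ (Data.Fin.suc i)) B

  Infinite : Set (c ⊔ ℓ)
  Infinite = Σ (ℕ → G) λ f → ∀ m k → f m ≈ f k → m ≡ k

  data Answer (n : ℕ) : Set where
    noZeroBasis : Answer n
    basis       : Subset n → Answer n

  Correct : ∀ {n} → Matroid n → (Fin n → G) → Answer n → Set ℓ
  Correct M ψ noZeroBasis = ∀ B → IsBasis M B → ¬ (sumSub ψ B ≈ ε)
  Correct M ψ (basis B)   = IsBasis M B × sumSub ψ B ≈ ε

-- Deterministic adaptive independence-oracle algorithms, as decision trees:
-- a node queries the independence of a subset and branches on the answer.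
data Tree (n : ℕ) (A : Set) : Set where
  leaf  : A → Tree n A
  query : Subset n → (Bool → Tree n A) → Tree n A

run : ∀ {n A} → Tree n A → Matroid n → A
run (leaf a)    M = a
run (query S k) M = run (k (indep M S)) M

queries : ∀ {n A} → Tree n A → Matroid n → ℕ
queries (leaf a)    M = zero
queries (query S k) M = suc (queries (k (indep M S)) M)

module _ {c ℓ : Level} (Γ : AbelianGroup c ℓ) where
  open AbelianGroup Γ renaming (Carrier to G)

  -- An algorithm receives n and the labeling ψ (with arbitrary computation
  -- allowed), and accesses the matroid only through the oracle.
  Algorithm : Set c
  Algorithm = (n : ℕ) → (Fin n → G) → Tree n (Answer Γ n)

  Solves : Algorithm → Set (c ⊔ ℓ)
  Solves A = ∀ n (ψ : Fin n → G) (M : Matroid n) → Correct Γ M ψ (run (A n ψ) M)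

-- Write n = 4t + s and split the ground set into t blocks of two pairs and s
-- single elements.  A pair is labelled (g, g⁻¹) and a single element g, with
-- generic generators g, so that the zero-sum sets are exactly the balanced
-- ones (unions of pairs).  Let M be the sparse paving matroid of rank 2t whose
-- circuit-hyperplanes are all balanced 2t-sets: it has no zero-sum basis.
-- Relaxing one of the 2^t balanced sets choice σ, which take one pair from each
-- block, gives a matroid M[ σ ] in which choice σ is a zero-sum basis and which
-- differs from M only at choice σ.  An algorithm asking fewer than 2^t queries
-- on M never asks about some choice σ, so it answers alike on M and M[ σ ], and
-- no answer is correct for both.  Generic generators exist because Γ is
-- infinite; choosing them needs decidable equality in Γ, which a Zero Basis
-- solver itself provides.
module Submission where

open import Defs
open import Level using (Level; _⊔_; 0ℓ)
open import Algebra.Bundles using (AbelianGroup)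
open import Data.Bool using (Bool; true; false; not)
import Data.Bool as Bool
open import Data.Empty using (⊥-elim) renaming (⊥ to Empty)
open import Data.Fin using (Fin; zero; suc; toℕ)
open import Data.Fin.Properties using (any?; all?; ¬∀⟶∃¬; pigeonhole; suc-injective)
open import Data.Fin.Subset using (Subset; ⊥; ⁅_⁆; _∪_; _∈_; _∉_; _⊆_; ∣_∣; inside; outside)
open import Data.Fin.Subset.Properties
  using (_∈?_; drop-∷-⊆; p⊆q⇒∣p∣≤∣q∣; ∪-identityʳ; ∣⊥∣≡0; p⊆p∪q; x∈p∪q⁺; x∈p∪q⁻; x∈⁅x⁆; x∈⁅y⁆⇒x≡y)
open import Data.List using (List; []; _∷_; length; lookup; map; _++_; replicate)
open import Data.List.Membership.Propositional using () renaming (_∈_ to _∈ₗ_; _∉_ to _∉ₗ_)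
open import Data.List.Membership.Propositional.Properties using (∈-map⁺; ∈-++⁺ˡ; ∈-++⁺ʳ)
open import Data.List.Properties using (length-map)
open import Data.List.Relation.Unary.All as All using (All)
open import Data.List.Relation.Unary.All.Properties using (¬Any⇒All¬)
open import Data.List.Relation.Unary.Any as Any using (Any; index)
open import Data.List.Relation.Unary.Any.Properties using (lookup-index)
open import Data.Nat using (ℕ; zero; suc; _+_; _*_; _^_; _/_; _%_; _≤_; _<_; _≤?_; _<?_; _≟_; z≤n; s≤s)
open import Data.Nat.DivMod using (m≡m%n+[m/n]*n; m≥n⇒m/n>0)
open import Data.Nat.Properties
  using (≤-trans; ≤-reflexive; ≤-antisym; <-irrefl; <⇒≱; ≮⇒≥; ≤-<-trans; n<1+n; 0≢1+n;
         +-comm; +-suc; +-identityʳ; +-cancelˡ-<; +-monoˡ-≤)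
open import Data.Product using (Σ; ∃; _×_; _,_; proj₁; proj₂)
open import Data.Sum using (inj₂; [_,_])
open import Data.Vec using (Vec; []; _∷_)
open import Data.Vec.Base using (here; there)
open import Data.Vec.Properties using (≡-dec)
open import Function using (id; _∘_; flip)
open import Function.Bundles using (mk⇔)
open import Relation.Binary using (Setoid)
import Relation.Binary as B
open import Relation.Binary.PropositionalEquality as ≡
  using (_≡_; _≢_; refl; sym; trans; cong; subst; subst₂)
open import Relation.Nullary using (¬_; Dec; yes; no; does; contradiction; ¬?; _×-dec_)
open import Relation.Nullary.Decidable using (dec-true; dec-false; does-⇔; decidable-stable; map′)
open import Relation.Unary using (Pred; Decidable)

p⊆q∧∣q∣≤∣p∣⇒p≡q : ∀ {n} {p q : Subset n} → p ⊆ q → ∣ q ∣ ≤ ∣ p ∣ → p ≡ q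
p⊆q∧∣q∣≤∣p∣⇒p≡q {p = []}          {[]}          _   _ = refl
p⊆q∧∣q∣≤∣p∣⇒p≡q {p = outside ∷ p} {outside ∷ q} p⊆q ∣q∣≤∣p∣ =
  cong (outside ∷_) (p⊆q∧∣q∣≤∣p∣⇒p≡q (drop-∷-⊆ p⊆q) ∣q∣≤∣p∣)
p⊆q∧∣q∣≤∣p∣⇒p≡q {p = inside ∷ p}  {inside ∷ q}  p⊆q (s≤s ∣q∣≤∣p∣) =
  cong (inside ∷_) (p⊆q∧∣q∣≤∣p∣⇒p≡q (drop-∷-⊆ p⊆q) ∣q∣≤∣p∣)
p⊆q∧∣q∣≤∣p∣⇒p≡q {p = inside ∷ p}  {outside ∷ q} p⊆q _ with p⊆q here
... | ()
p⊆q∧∣q∣≤∣p∣⇒p≡q {p = outside ∷ p} {inside ∷ q}  p⊆q ∣q∣≤∣p∣ =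
  contradiction (≤-trans ∣q∣≤∣p∣ (p⊆q⇒∣p∣≤∣q∣ (drop-∷-⊆ p⊆q))) (<-irrefl refl)

p⊈q⇒∃∈p∉q : ∀ {n} {p q : Subset n} → ¬ p ⊆ q → ∃ λ x → x ∈ p × x ∉ q
p⊈q⇒∃∈p∉q {p = p} {q} p⊈q with any? (λ x → x ∈? p ×-dec ¬? (x ∈? q))
... | yes x∈p∖q = x∈p∖q
... | no ∄x = contradiction (λ {x} x∈p → decidable-stable (x ∈? q) (λ x∉q → ∄x (x , x∈p , x∉q))) p⊈q

∣p∪⁅x⁆∣≡1+∣p∣ : ∀ {n} {p : Subset n} {x} → x ∉ p → ∣ p ∪ ⁅ x ⁆ ∣ ≡ 1 + ∣ p ∣
∣p∪⁅x⁆∣≡1+∣p∣ {p = inside ∷ p}  {zero}  x∉p = contradiction here x∉p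
∣p∪⁅x⁆∣≡1+∣p∣ {p = outside ∷ p} {zero}  _   = cong (λ q → 1 + ∣ q ∣) (∪-identityʳ p)
∣p∪⁅x⁆∣≡1+∣p∣ {p = inside ∷ p}  {suc x} x∉p = cong (1 +_) (∣p∪⁅x⁆∣≡1+∣p∣ (x∉p ∘ there))
∣p∪⁅x⁆∣≡1+∣p∣ {p = outside ∷ p} {suc x} x∉p = ∣p∪⁅x⁆∣≡1+∣p∣ (x∉p ∘ there)

x∈p∪⁅x⁆ : ∀ {n} (p : Subset n) x → x ∈ p ∪ ⁅ x ⁆
x∈p∪⁅x⁆ p x = x∈p∪q⁺ (inj₂ (x∈⁅x⁆ x))

dec-true⁻¹ : ∀ {a} {A : Set a} (a? : Dec A) → does a? ≡ true → A
dec-true⁻¹ (yes a) _ = a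

indep≤basis : ∀ {n} (M : Matroid n) {B J} → IsBasis M B → indep M J ≡ true → ∣ J ∣ ≤ ∣ B ∣
indep≤basis M (B-indep , B-maximal) J-indep = ≮⇒≥ λ ∣B∣<∣J∣ →
  let (e , _ , e∉B , B∪e-indep) = indep-aug M B-indep J-indep ∣B∣<∣J∣
  in contradiction (trans (sym B∪e-indep) (B-maximal e e∉B)) λ ()

-- Sparse paving matroids and their relaxations

-- The Bad sets are the circuit-hyperplanes of the matroid; every other set of
-- size at most r is independent.
record SparsePaving (n r : ℕ) b : Set (Level.suc b) where
  field
    Bad        : Pred (Subset n) b
    bad?       : Decidable Bad
    bad-size   : ∀ {S} → Bad S → ∣ S ∣ ≡ r
    bad-sparse : ∀ {I x y} → x ∉ I → y ∉ I → Bad (I ∪ ⁅ x ⁆) → Bad (I ∪ ⁅ y ⁆) → x ≡ y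
    ¬bad-⊥     : ¬ Bad ⊥

module _ {n r b} (F : SparsePaving n r b) where
  open SparsePaving F

  Indep : Pred (Subset n) b
  Indep S = ∣ S ∣ ≤ r × ¬ Bad S

  indep? : Decidable Indep
  indep? S = ∣ S ∣ ≤? r ×-dec ¬? (bad? S)

  private
    Indep-∅ : Indep ⊥
    Indep-∅ = subst (_≤ r) (sym (∣⊥∣≡0 n)) z≤n , ¬bad-⊥

    Indep-down : ∀ {I J} → J ⊆ I → Indep I → Indep J
    Indep-down {I} {J} J⊆I (∣I∣≤r , ¬bad-I) = ≤-trans (p⊆q⇒∣p∣≤∣q∣ J⊆I) ∣I∣≤r , λ bad-J →
      ¬bad-I (subst Bad (p⊆q∧∣q∣≤∣p∣⇒p≡q J⊆I (≤-trans ∣I∣≤r (≤-reflexive (sym (bad-size bad-J))))) bad-J)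

    extend : ∀ {I x} → x ∉ I → ∣ I ∣ < r → ¬ Bad (I ∪ ⁅ x ⁆) → Indep (I ∪ ⁅ x ⁆)
    extend x∉I ∣I∣<r ¬bad = subst (_≤ r) (sym (∣p∪⁅x⁆∣≡1+∣p∣ x∉I)) ∣I∣<r , ¬bad

    -- If I ∪ {x} is bad, then J ⊈ I ∪ {x} yields a second candidate y, and
    -- I ∪ {y} cannot be bad as well by sparseness.
    Indep-aug : ∀ {I J} → Indep I → Indep J → ∣ I ∣ < ∣ J ∣ →
                ∃ λ x → x ∈ J × x ∉ I × Indep (I ∪ ⁅ x ⁆)
    Indep-aug {I} {J} _ (∣J∣≤r , ¬bad-J) ∣I∣<∣J∣
      with p⊈q⇒∃∈p∉q (λ J⊆I → <⇒≱ ∣I∣<∣J∣ (p⊆q⇒∣p∣≤∣q∣ J⊆I))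
    ... | x , x∈J , x∉I with bad? (I ∪ ⁅ x ⁆)
    ...   | no ¬bad = x , x∈J , x∉I , extend x∉I (≤-trans ∣I∣<∣J∣ ∣J∣≤r) ¬bad
    ...   | yes bad with p⊈q⇒∃∈p∉q J⊈I∪x
      where
      J⊈I∪x : ¬ J ⊆ I ∪ ⁅ x ⁆
      J⊈I∪x J⊆I∪x = ¬bad-J (subst Bad (sym (p⊆q∧∣q∣≤∣p∣⇒p≡q J⊆I∪x
        (subst (_≤ ∣ J ∣) (sym (∣p∪⁅x⁆∣≡1+∣p∣ x∉I)) ∣I∣<∣J∣))) bad)
    ...     | y , y∈J , y∉I∪x = y , y∈J , y∉I , extend y∉I ∣I∣<r λ bad-y →
                y∉I∪x (subst (_∈ I ∪ ⁅ x ⁆) (bad-sparse x∉I y∉I bad bad-y) (x∈p∪⁅x⁆ I x))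
      where
      y∉I : y ∉ I
      y∉I = y∉I∪x ∘ p⊆p∪q ⁅ x ⁆
      ∣I∣<r : ∣ I ∣ < r
      ∣I∣<r = subst (_≤ r) (∣p∪⁅x⁆∣≡1+∣p∣ x∉I) (≤-reflexive (bad-size bad))

  sparsePaving : Matroid n
  sparsePaving = record
    { indep      = does ∘ indep?
    ; indep-∅    = dec-true (indep? ⊥) Indep-∅
    ; indep-down = λ J⊆I I-indep → dec-true (indep? _) (Indep-down J⊆I (dec-true⁻¹ (indep? _) I-indep))
    ; indep-aug  = λ I-indep J-indep ∣I∣<∣J∣ →
        let (x , x∈J , x∉I , I∪x-indep) = Indep-aug (dec-true⁻¹ (indep? _) I-indep)
                                                     (dec-true⁻¹ (indep? _) J-indep) ∣I∣<∣J∣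
        in x , x∈J , x∉I , dec-true (indep? _) I∪x-indep
    }

  Indep∧rank⇒basis : ∀ {S} → Indep S → ∣ S ∣ ≡ r → IsBasis sparsePaving S
  Indep∧rank⇒basis {S} S-indep ∣S∣≡r = dec-true (indep? S) S-indep , λ x x∉S →
    dec-false (indep? (S ∪ ⁅ x ⁆)) λ (∣S∪x∣≤r , _) →
      <-irrefl refl (≤-trans (subst (r <_) (sym (trans (∣p∪⁅x⁆∣≡1+∣p∣ x∉S) (cong (1 +_) ∣S∣≡r))) (n<1+n r))
                             ∣S∪x∣≤r)

relax : ∀ {n r b} → SparsePaving n r b → Subset n → SparsePaving n r b
relax F X = record
  { Bad        = λ S → Bad S × S ≢ X
  ; bad?       = λ S → bad? S ×-dec ¬? (≡-dec Bool._≟_ S X)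
  ; bad-size   = bad-size ∘ proj₁
  ; bad-sparse = λ x∉I y∉I (bad-x , _) (bad-y , _) → bad-sparse x∉I y∉I bad-x bad-y
  ; ¬bad-⊥     = ¬bad-⊥ ∘ proj₁
  }
  where open SparsePaving F

module _ {n r b} (F : SparsePaving n r b) (X : Subset n) where

  relax-basis : ∣ X ∣ ≡ r → IsBasis (sparsePaving (relax F X)) X
  relax-basis ∣X∣≡r = Indep∧rank⇒basis (relax F X) (≤-reflexive ∣X∣≡r , λ (_ , X≢X) → X≢X refl) ∣X∣≡r

  relax-agrees : ∀ {S} → S ≢ X → indep (sparsePaving (relax F X)) S ≡ indep (sparsePaving F) S
  relax-agrees S≢X = does-⇔ (mk⇔ (λ (≤r , ¬bad′) → ≤r , λ bad → ¬bad′ (bad , S≢X))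
                                 (λ (≤r , ¬bad) → ≤r , ¬bad ∘ proj₁))
                            (indep? (relax F X) _) (indep? F _)

free : ∀ n → Matroid n
free n = sparsePaving {r = n} record
  { Bad        = λ _ → Empty
  ; bad?       = λ _ → no λ ()
  ; bad-size   = λ ()
  ; bad-sparse = λ _ _ ()
  ; ¬bad-⊥     = λ ()
  }

-- Oracle algorithms

queried : ∀ {n A} → Tree n A → Matroid n → List (Subset n)
queried (leaf _)    M = []
queried (query S k) M = S ∷ queried (k (indep M S)) M

length-queried : ∀ {n A} (T : Tree n A) M → length (queried T M) ≡ queries T M
length-queried (leaf _)    M = refl
length-queried (query S k) M = cong (1 +_) (length-queried (k (indep M S)) M)

run-cong : ∀ {n A} (T : Tree n A) {M M′} → (∀ {S} → S ∈ₗ queried T M → indep M′ S ≡ indep M S) →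
           run T M′ ≡ run T M
run-cong (leaf _)    agree = refl
run-cong (query S k) {M} agree rewrite agree (Any.here refl) = run-cong (k (indep M S)) (agree ∘ Any.there)

tailsWith : ∀ {t} → Bool → List (Vec Bool (1 + t)) → List (Vec Bool t)
tailsWith b     []                = []
tailsWith true  ((true  ∷ σ) ∷ L) = σ ∷ tailsWith true L
tailsWith false ((false ∷ σ) ∷ L) = σ ∷ tailsWith false L
tailsWith true  ((false ∷ _) ∷ L) = tailsWith true L
tailsWith false ((true  ∷ _) ∷ L) = tailsWith false L

length-tailsWith : ∀ {t} (L : List (Vec Bool (1 + t))) →
                   length L ≡ length (tailsWith false L) + length (tailsWith true L)
length-tailsWith []                = refl
length-tailsWith ((false ∷ _) ∷ L) = cong (1 +_) (length-tailsWith L)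
length-tailsWith ((true  ∷ _) ∷ L) = trans (cong (1 +_) (length-tailsWith L)) (sym (+-suc _ _))

∈-tailsWith : ∀ {t b σ} {L : List (Vec Bool (1 + t))} → (b ∷ σ) ∈ₗ L → σ ∈ₗ tailsWith b L
∈-tailsWith {b = true}  {L = (true  ∷ _) ∷ _} (Any.here refl) = Any.here refl
∈-tailsWith {b = false} {L = (false ∷ _) ∷ _} (Any.here refl) = Any.here refl
∈-tailsWith {b = true}  {L = (true  ∷ _) ∷ _} (Any.there σ∈L) = Any.there (∈-tailsWith σ∈L)
∈-tailsWith {b = false} {L = (false ∷ _) ∷ _} (Any.there σ∈L) = Any.there (∈-tailsWith σ∈L)
∈-tailsWith {b = true}  {L = (false ∷ _) ∷ _} (Any.there σ∈L) = ∈-tailsWith σ∈L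
∈-tailsWith {b = false} {L = (true  ∷ _) ∷ _} (Any.there σ∈L) = ∈-tailsWith σ∈L

length<2^⇒∃∉ : ∀ t (L : List (Vec Bool t)) → length L < 2 ^ t → ∃ λ σ → σ ∉ₗ L
length<2^⇒∃∉ zero    []      _       = [] , λ ()
length<2^⇒∃∉ zero    (_ ∷ _) (s≤s ())
length<2^⇒∃∉ (suc t) L       ∣L∣<2^1+t with length (tailsWith false L) <? 2 ^ t
... | yes short = let (σ , σ∉) = length<2^⇒∃∉ t (tailsWith false L) short in false ∷ σ , σ∉ ∘ ∈-tailsWith
... | no ¬short = let (σ , σ∉) = length<2^⇒∃∉ t (tailsWith true L) short in true ∷ σ , σ∉ ∘ ∈-tailsWith
  where
  short : length (tailsWith true L) < 2 ^ t
  short = +-cancelˡ-< (2 ^ t) _ _ (≤-<-trans (+-monoˡ-≤ _ (≮⇒≥ ¬short))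
            (subst₂ _<_ (length-tailsWith L) (cong (2 ^ t +_) (+-identityʳ (2 ^ t))) ∣L∣<2^1+t))

module _ {n t} (X : Vec Bool t → Subset n) (X⁻¹ : Subset n → Vec Bool t) (X⁻¹∘X : ∀ σ → X⁻¹ (X σ) ≡ σ) where

  unqueried : ∀ {A} (T : Tree n A) M → queries T M < 2 ^ t → ∃ λ σ → X σ ∉ₗ queried T M
  unqueried T M few with length<2^⇒∃∉ t (map X⁻¹ (queried T M))
                          (subst (_< 2 ^ t) (sym (trans (length-map X⁻¹ (queried T M)) (length-queried T M))) few)
  ... | σ , σ∉ = σ , λ Xσ∈ → σ∉ (subst (_∈ₗ map X⁻¹ (queried T M)) (X⁻¹∘X σ) (∈-map⁺ X⁻¹ Xσ∈))

-- Balanced subsets of a list of pairs and singles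

data Part : Set where
  pair single : Part

size : List Part → ℕ
size []           = 0
size (pair ∷ L)   = 2 + size L
size (single ∷ L) = 1 + size L

data Balanced : (L : List Part) → Subset (size L) → Set where
  []     : Balanced [] []
  pair   : ∀ {L S} b → Balanced L S → Balanced (pair ∷ L) (b ∷ b ∷ S)
  single : ∀ {L S} → Balanced L S → Balanced (single ∷ L) (outside ∷ S)

balanced? : ∀ L → Decidable (Balanced L)
balanced? []           []          = yes []
balanced? (pair ∷ L)   (x ∷ y ∷ S) with x Bool.≟ y | balanced? L S
... | yes refl | yes bal = yes (pair x bal)
... | no x≢y   | _       = no λ { (pair _ _) → x≢y refl }
... | yes _    | no ¬bal = no λ { (pair _ bal) → ¬bal bal }
balanced? (single ∷ L) (inside ∷ S)  = no λ ()
balanced? (single ∷ L) (outside ∷ S) = map′ single (λ { (single bal) → bal }) (balanced? L S)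

⊥-balanced : ∀ L → Balanced L ⊥
⊥-balanced []           = []
⊥-balanced (pair ∷ L)   = pair false (⊥-balanced L)
⊥-balanced (single ∷ L) = single (⊥-balanced L)

partner : ∀ L → Fin (size L) → Fin (size L)
partner (pair ∷ L)   zero          = suc zero
partner (pair ∷ L)   (suc zero)    = zero
partner (pair ∷ L)   (suc (suc x)) = suc (suc (partner L x))
partner (single ∷ L) zero          = zero
partner (single ∷ L) (suc x)       = suc (partner L x)

partner-involutive : ∀ L x → partner L (partner L x) ≡ x
partner-involutive (pair ∷ L)   zero          = refl
partner-involutive (pair ∷ L)   (suc zero)    = refl
partner-involutive (pair ∷ L)   (suc (suc x)) = cong (Fin.suc ∘ Fin.suc) (partner-involutive L x)
partner-involutive (single ∷ L) zero          = refl
partner-involutive (single ∷ L) (suc x)       = cong Fin.suc (partner-involutive L x)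

balanced-partner : ∀ {L S x} → Balanced L S → x ∈ S → partner L x ∈ S × partner L x ≢ x
balanced-partner (pair true _) here                = there here , λ ()
balanced-partner (pair true _) (there here)        = here , λ ()
balanced-partner (pair _ bal)  (there (there x∈S)) =
  let (p∈S , p≢x) = balanced-partner bal x∈S in there (there p∈S) , p≢x ∘ suc-injective ∘ suc-injective
balanced-partner (single bal)  (there x∈S)         =
  let (p∈S , p≢x) = balanced-partner bal x∈S in there p∈S , p≢x ∘ suc-injective

-- The partner of x lies in I, hence in I ∪ {y}, and so must its partner x.
balanced-sparse : ∀ {L I x y} → x ∉ I → Balanced L (I ∪ ⁅ x ⁆) → Balanced L (I ∪ ⁅ y ⁆) → x ≡ y
balanced-sparse {L} {I} {x} {y} x∉I bal-x bal-y =
  [ flip contradiction x∉I , x∈⁅y⁆⇒x≡y y ] (x∈p∪q⁻ I ⁅ y ⁆ x∈I∪y)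
  where
  partner∈I : partner L x ∈ I
  partner∈I with balanced-partner bal-x (x∈p∪⁅x⁆ I x)
  ... | p∈I∪x , p≢x = [ id , ⊥-elim ∘ p≢x ∘ x∈⁅y⁆⇒x≡y x ] (x∈p∪q⁻ I ⁅ x ⁆ p∈I∪x)
  x∈I∪y : x ∈ I ∪ ⁅ y ⁆
  x∈I∪y = subst (_∈ I ∪ ⁅ y ⁆) (partner-involutive L x)
                (proj₁ (balanced-partner bal-y (p⊆p∪q ⁅ y ⁆ partner∈I)))

blocks : ℕ → ℕ → List Part
blocks zero    s = replicate s single
blocks (suc t) s = pair ∷ pair ∷ blocks t s

size-blocks : ∀ t s → size (blocks t s) ≡ t * 4 + s
size-blocks zero    zero    = refl
size-blocks zero    (suc s) = cong (1 +_) (size-blocks zero s)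
size-blocks (suc t) s       = cong (4 +_) (size-blocks t s)

module _ (s : ℕ) where

  choice : ∀ {t} → Vec Bool t → Subset (size (blocks t s))
  choice []      = ⊥
  choice (b ∷ σ) = b ∷ b ∷ not b ∷ not b ∷ choice σ

  choice⁻¹ : ∀ t → Subset (size (blocks t s)) → Vec Bool t
  choice⁻¹ zero    _                   = []
  choice⁻¹ (suc t) (b ∷ _ ∷ _ ∷ _ ∷ S) = b ∷ choice⁻¹ t S

  choice⁻¹∘choice : ∀ {t} (σ : Vec Bool t) → choice⁻¹ t (choice σ) ≡ σ
  choice⁻¹∘choice []      = refl
  choice⁻¹∘choice (b ∷ σ) = cong (b ∷_) (choice⁻¹∘choice σ)

  balanced-choice : ∀ {t} (σ : Vec Bool t) → Balanced (blocks t s) (choice σ)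
  balanced-choice []      = ⊥-balanced (blocks zero s)
  balanced-choice (b ∷ σ) = pair b (pair (not b) (balanced-choice σ))

  ∣choice∣ : ∀ {t} (σ : Vec Bool t) → ∣ choice σ ∣ ≡ t * 2
  ∣choice∣ []          = ∣⊥∣≡0 (size (blocks zero s))
  ∣choice∣ (true  ∷ σ) = cong (2 +_) (∣choice∣ σ)
  ∣choice∣ (false ∷ σ) = cong (2 +_) (∣choice∣ σ)

  firsts : ∀ t → Subset (size (blocks t s))
  firsts zero    = ⊥
  firsts (suc t) = inside ∷ outside ∷ inside ∷ outside ∷ firsts t

  ∣firsts∣ : ∀ t → ∣ firsts t ∣ ≡ t * 2
  ∣firsts∣ zero    = ∣⊥∣≡0 (size (blocks zero s))
  ∣firsts∣ (suc t) = cong (2 +_) (∣firsts∣ t)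

-- Labels in an abelian group

module _ {a ℓ} (S : Setoid a ℓ) where
  open Setoid S using (Carrier; _≈_; _≉_) renaming (trans to ≈-trans; sym to ≈-sym)

  module _ (_≈?_ : B.Decidable _≈_) (f : ℕ → Carrier) (f-injective : ∀ m k → f m ≈ f k → m ≡ k) where

    -- Pigeonhole: f 0, …, f (length V) cannot all be equal to elements of V.
    escape : (V : List Carrier) → ∃ λ i → All (f i ≉_) V
    escape V with all? (λ (i : Fin (1 + length V)) → Any.any? (f (toℕ i) ≈?_) V)
    ... | no ¬all = let (i , fi∉V) = ¬∀⟶∃¬ _ _ (λ i → Any.any? (f (toℕ i) ≈?_) V) ¬all
                    in toℕ i , ¬Any⇒All¬ V fi∉V
    ... | yes all∈V with pigeonhole (n<1+n (length V)) (λ i → index (all∈V i))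
    ...   | i , j , i<j , same = contradiction (f-injective _ _ fi≈fj) λ i≡j → <-irrefl i≡j i<j
      where
      fi≈fj : f (toℕ i) ≈ f (toℕ j)
      fi≈fj = ≈-trans (lookup-index (all∈V i))
                      (≈-sym (subst (λ k → f (toℕ j) ≈ lookup V k) (≡.sym same) (lookup-index (all∈V j))))

module _ {c ℓ} (Γ : AbelianGroup c ℓ) where
  open AbelianGroup Γ renaming (Carrier to G; refl to ≈-refl; sym to ≈-sym; trans to ≈-trans)
  open import Algebra.Properties.AbelianGroup Γ using (inverseˡ-unique; ⁻¹-injective; x∙y⁻¹≈ε⇒x≈y; x≈y⇒x∙y⁻¹≈ε)
  open import Relation.Binary.Reasoning.Setoid setoid

  data SignedSum : ∀ {m} → Vec G m → G → Set c where
    []    : SignedSum [] ε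
    skip  : ∀ {m g s} {gs : Vec G m} → SignedSum gs s → SignedSum (g ∷ gs) s
    plus  : ∀ {m g s} {gs : Vec G m} → SignedSum gs s → SignedSum (g ∷ gs) (g ∙ s)
    minus : ∀ {m g s} {gs : Vec G m} → SignedSum gs s → SignedSum (g ∷ gs) (g ⁻¹ ∙ s)

  data Generic : ∀ {m} → Vec G m → Set (c ⊔ ℓ) where
    []  : Generic []
    _∷_ : ∀ {m g} {gs : Vec G m} → (∀ {s} → SignedSum gs s → g ∙ s ≉ ε × g ⁻¹ ∙ s ≉ ε) →
          Generic gs → Generic (g ∷ gs)

  signedSums : ∀ {m} → Vec G m → List G
  signedSums []       = ε ∷ []
  signedSums (g ∷ gs) = signedSums gs ++ map (g ∙_) (signedSums gs) ++ map (g ⁻¹ ∙_) (signedSums gs)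

  ∈-signedSums : ∀ {m} {gs : Vec G m} {s} → SignedSum gs s → s ∈ₗ signedSums gs
  ∈-signedSums []                      = Any.here refl
  ∈-signedSums (skip s)                = ∈-++⁺ˡ (∈-signedSums s)
  ∈-signedSums {gs = g ∷ gs} (plus s)  =
    ∈-++⁺ʳ (signedSums gs) (∈-++⁺ˡ (∈-map⁺ (g ∙_) (∈-signedSums s)))
  ∈-signedSums {gs = g ∷ gs} (minus s) =
    ∈-++⁺ʳ (signedSums gs) (∈-++⁺ʳ (map (g ∙_) (signedSums gs)) (∈-map⁺ (g ⁻¹ ∙_) (∈-signedSums s)))

  module _ (_≈?_ : B.Decidable _≈_) (f : ℕ → G) (f-injective : ∀ m k → f m ≈ f k → m ≡ k) where

    -- g ∙ s ≈ ε forces g ≈ s ⁻¹ and g ⁻¹ ∙ s ≈ ε forces g ≈ s, so the new generator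
    -- only has to avoid these values for the signed sums s of the old ones.
    generic : ∀ m → ∃ (Generic {m})
    generic zero    = [] , []
    generic (suc m) with generic m
    ... | gs , gs-generic with escape setoid _≈?_ f f-injective (map _⁻¹ (signedSums gs) ++ signedSums gs)
    ...   | i , avoids = f i ∷ gs , (λ s → avoid-inverse s , avoid-self s) ∷ gs-generic
      where
      avoid-inverse : ∀ {s} → SignedSum gs s → f i ∙ s ≉ ε
      avoid-inverse s fi∙s≈ε = All.lookup avoids (∈-++⁺ˡ (∈-map⁺ _⁻¹ (∈-signedSums s)))
                                 (inverseˡ-unique _ _ fi∙s≈ε)
      avoid-self : ∀ {s} → SignedSum gs s → f i ⁻¹ ∙ s ≉ ε
      avoid-self s fi⁻¹∙s≈ε = All.lookup avoids (∈-++⁺ʳ (map _⁻¹ (signedSums gs)) (∈-signedSums s))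
                                (⁻¹-injective (inverseˡ-unique _ _ fi⁻¹∙s≈ε))

  label : ∀ L → Vec G (length L) → Fin (size L) → G
  label (pair ∷ L)   (g ∷ gs) zero          = g
  label (pair ∷ L)   (g ∷ gs) (suc zero)    = g ⁻¹
  label (pair ∷ L)   (g ∷ gs) (suc (suc i)) = label L gs i
  label (single ∷ L) (g ∷ gs) zero          = g
  label (single ∷ L) (g ∷ gs) (suc i)       = label L gs i

  private
    cancel : ∀ g x → g ∙ (g ⁻¹ ∙ x) ≈ x
    cancel g x = begin
      g ∙ (g ⁻¹ ∙ x)  ≈⟨ assoc g (g ⁻¹) x ⟨
      g ∙ g ⁻¹ ∙ x    ≈⟨ ∙-congʳ (inverseʳ g) ⟩
      ε ∙ x           ≈⟨ identityˡ x ⟩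
      x               ∎

    ε∙ε∙ : ∀ x → ε ∙ (ε ∙ x) ≈ x
    ε∙ε∙ x = ≈-trans (identityˡ _) (identityˡ x)

  balanced⇒sum≈ε : ∀ {L S} (gs : Vec G (length L)) → Balanced L S → sumSub Γ (label L gs) S ≈ ε
  balanced⇒sum≈ε []       []               = ≈-refl
  balanced⇒sum≈ε (g ∷ gs) (pair true bal)  = ≈-trans (cancel g _) (balanced⇒sum≈ε gs bal)
  balanced⇒sum≈ε (g ∷ gs) (pair false bal) = ≈-trans (ε∙ε∙ _) (balanced⇒sum≈ε gs bal)
  balanced⇒sum≈ε (g ∷ gs) (single bal)     = ≈-trans (identityˡ _) (balanced⇒sum≈ε gs bal)

  sum-signed : ∀ L (gs : Vec G (length L)) S → ∃ λ s → SignedSum gs s × sumSub Γ (label L gs) S ≈ s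
  sum-signed []           []       []          = ε , [] , ≈-refl
  sum-signed (pair ∷ L)   (g ∷ gs) (x ∷ y ∷ S) with sum-signed L gs S
  sum-signed (pair ∷ L)   (g ∷ gs) (true  ∷ true  ∷ S) | s , signed , sum≈s =
    s , skip signed , ≈-trans (cancel g _) sum≈s
  sum-signed (pair ∷ L)   (g ∷ gs) (true  ∷ false ∷ S) | s , signed , sum≈s =
    g ∙ s , plus signed , ∙-congˡ (≈-trans (identityˡ _) sum≈s)
  sum-signed (pair ∷ L)   (g ∷ gs) (false ∷ true  ∷ S) | s , signed , sum≈s =
    g ⁻¹ ∙ s , minus signed , ≈-trans (identityˡ _) (∙-congˡ sum≈s)
  sum-signed (pair ∷ L)   (g ∷ gs) (false ∷ false ∷ S) | s , signed , sum≈s =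
    s , skip signed , ≈-trans (ε∙ε∙ _) sum≈s
  sum-signed (single ∷ L) (g ∷ gs) (x ∷ S) with sum-signed L gs S
  sum-signed (single ∷ L) (g ∷ gs) (true  ∷ S) | s , signed , sum≈s = g ∙ s , plus signed , ∙-congˡ sum≈s
  sum-signed (single ∷ L) (g ∷ gs) (false ∷ S) | s , signed , sum≈s =
    s , skip signed , ≈-trans (identityˡ _) sum≈s

  sum≈ε⇒balanced : ∀ L {gs : Vec G (length L)} {S} → Generic gs → sumSub Γ (label L gs) S ≈ ε → Balanced L S
  sum≈ε⇒balanced []           {[]}     {[]}                _             _     = []
  sum≈ε⇒balanced (pair ∷ L)   {g ∷ gs} {true  ∷ true  ∷ S} (_ ∷ generic) sum≈ε =
    pair true (sum≈ε⇒balanced L generic (≈-trans (≈-sym (cancel g _)) sum≈ε))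
  sum≈ε⇒balanced (pair ∷ L)   {g ∷ gs} {false ∷ false ∷ S} (_ ∷ generic) sum≈ε =
    pair false (sum≈ε⇒balanced L generic (≈-trans (≈-sym (ε∙ε∙ _)) sum≈ε))
  sum≈ε⇒balanced (pair ∷ L)   {g ∷ gs} {true  ∷ false ∷ S} (avoids ∷ _)  sum≈ε =
    let s , signed , sum≈s = sum-signed L gs S
    in contradiction (≈-trans (∙-congˡ (≈-sym (≈-trans (identityˡ _) sum≈s))) sum≈ε) (proj₁ (avoids signed))
  sum≈ε⇒balanced (pair ∷ L)   {g ∷ gs} {false ∷ true  ∷ S} (avoids ∷ _)  sum≈ε =
    let s , signed , sum≈s = sum-signed L gs S
    in contradiction (≈-trans (≈-sym (≈-trans (identityˡ _) (∙-congˡ sum≈s))) sum≈ε) (proj₂ (avoids signed))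
  sum≈ε⇒balanced (single ∷ L) {g ∷ gs} {true  ∷ S}         (avoids ∷ _)  sum≈ε =
    let s , signed , sum≈s = sum-signed L gs S
    in contradiction (≈-trans (∙-congˡ (≈-sym sum≈s)) sum≈ε) (proj₁ (avoids signed))
  sum≈ε⇒balanced (single ∷ L) {g ∷ gs} {false ∷ S}         (_ ∷ generic) sum≈ε =
    single (sum≈ε⇒balanced L generic (≈-trans (≈-sym (identityˡ _)) sum≈ε))

  -- The adversary argument

  no-common-answer : ∀ {n} {ψ : Fin n → G} {M M′ X} →
                     (∀ {B} → IsBasis M B → sumSub Γ ψ B ≉ ε) → IsBasis M′ X → sumSub Γ ψ X ≈ ε →
                     ∀ a → Correct Γ M ψ a → ¬ Correct Γ M′ ψ a
  no-common-answer _         X-basis X-sum≈ε noZeroBasis _                   none = none _ X-basis X-sum≈ε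
  no-common-answer no-zero-M _       _       (basis B)   (B-basis , B-sum≈ε) _    = no-zero-M B-basis B-sum≈ε

  module _ (A : Algorithm Γ) (solves : Solves Γ A) where

    -- On the free matroid with one element labelled g, the only basis is that
    -- element, so the answer of A decides g ≈ ε.
    ≈ε? : ∀ g → Dec (g ≈ ε)
    ≈ε? g with run (A 1 λ _ → g) (free 1) | solves 1 (λ _ → g) (free 1)
    ... | noZeroBasis          | none              =
      no λ g≈ε → none (inside ∷ []) (refl , λ { zero 0∉ → contradiction here 0∉ }) (≈-trans (identityʳ g) g≈ε)
    ... | basis (inside ∷ [])  | _ , sum≈ε         = yes (≈-trans (≈-sym (identityʳ g)) sum≈ε)
    ... | basis (outside ∷ []) | (_ , maximal) , _ = contradiction (maximal zero λ ()) λ ()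

    _≈?_ : B.Decidable _≈_
    x ≈? y = map′ (x∙y⁻¹≈ε⇒x≈y x y) x≈y⇒x∙y⁻¹≈ε (≈ε? (x ∙ y ⁻¹))

    module HardInstance (t s : ℕ) {gs : Vec G (length (blocks (suc t) s))} (gs-generic : Generic gs) where

      n : ℕ
      n = size (blocks (suc t) s)

      ψ : Fin n → G
      ψ = label (blocks (suc t) s) gs

      balancedCircuitHyperplanes : SparsePaving n (suc t * 2) 0ℓ
      balancedCircuitHyperplanes = record
        { Bad        = λ S → Balanced (blocks (suc t) s) S × ∣ S ∣ ≡ suc t * 2
        ; bad?       = λ S → balanced? _ S ×-dec (∣ S ∣ ≟ suc t * 2)
        ; bad-size   = proj₂
        ; bad-sparse = λ x∉I _ (bal-x , _) (bal-y , _) → balanced-sparse x∉I bal-x bal-y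
        ; ¬bad-⊥     = λ (_ , ∣⊥∣≡r) → 0≢1+n (trans (sym (∣⊥∣≡0 n)) ∣⊥∣≡r)
        }

      M : Matroid n
      M = sparsePaving balancedCircuitHyperplanes

      M[_] : Vec Bool (suc t) → Matroid n
      M[ σ ] = sparsePaving (relax balancedCircuitHyperplanes (choice s σ))

      -- A zero-sum basis B is balanced, and no smaller than the independent set
      -- firsts, so B itself would be one of the excluded balanced sets.
      no-zero-basis : ∀ {B} → IsBasis M B → sumSub Γ ψ B ≉ ε
      no-zero-basis {B} B-basis@(B-indep , _) sum≈ε =
        ¬bad (sum≈ε⇒balanced _ gs-generic sum≈ε , ≤-antisym ∣B∣≤r r≤∣B∣)
        where
        ∣B∣≤r = proj₁ (dec-true⁻¹ (indep? balancedCircuitHyperplanes B) B-indep)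
        ¬bad  = proj₂ (dec-true⁻¹ (indep? balancedCircuitHyperplanes B) B-indep)
        firsts-indep : indep M (firsts s (suc t)) ≡ true
        firsts-indep = dec-true (indep? balancedCircuitHyperplanes (firsts s (suc t)))
                                (≤-reflexive (∣firsts∣ s (suc t)) , λ { (() , _) })
        r≤∣B∣ : suc t * 2 ≤ ∣ B ∣
        r≤∣B∣ = subst (_≤ ∣ B ∣) (∣firsts∣ s (suc t)) (indep≤basis M {J = firsts s (suc t)} B-basis firsts-indep)

      lower-bound : 2 ^ suc t ≤ queries (A n ψ) M
      lower-bound = ≮⇒≥ λ few →
        let σ , unqueried-σ = unqueried (choice s) (choice⁻¹ s (suc t)) (choice⁻¹∘choice s) (A n ψ) M few
            same-run : run (A n ψ) M[ σ ] ≡ run (A n ψ) M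
            same-run = run-cong (A n ψ) λ S∈ → relax-agrees balancedCircuitHyperplanes (choice s σ)
                         λ S≡choice → unqueried-σ (subst (_∈ₗ _) S≡choice S∈)
        in no-common-answer no-zero-basis (relax-basis balancedCircuitHyperplanes (choice s σ) (∣choice∣ s σ))
             (balanced⇒sum≈ε gs (balanced-choice s σ)) (run (A n ψ) M) (solves n ψ M)
             (subst (Correct Γ M[ σ ] ψ) same-run (solves n ψ M[ σ ]))

    hard-instance : Infinite Γ → ∀ t s → 0 < t →
                    Σ (Fin (size (blocks t s)) → G) λ ψ → Σ (Matroid (size (blocks t s))) λ M →
                      2 ^ t ≤ queries (A _ ψ) M
    hard-instance (f , f-injective) (suc t) s _ = ψ , M , lower-bound
      where open HardInstance t s (proj₂ (generic _≈?_ f f-injective _))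

size-blocks-divMod : ∀ n → size (blocks (n / 4) (n % 4)) ≡ n
size-blocks-divMod n =
  trans (size-blocks (n / 4) (n % 4)) (trans (+-comm (n / 4 * 4) (n % 4)) (sym (m≡m%n+[m/n]*n n 4)))

mainTheorem17 : ∀ {c ℓ : Level} (Γ : AbelianGroup c ℓ) → Infinite Γ →
    (A : Algorithm Γ) → Solves Γ A →
    Σ ℕ λ k → Σ ℕ λ N → ∀ n → N ≤ n →
      Σ (Fin n → AbelianGroup.Carrier Γ) λ ψ → Σ (Matroid n) λ M →
        2 ^ (n / suc k) ≤ queries (A n ψ) M
mainTheorem17 Γ infinite A solves = 3 , 4 , λ n 4≤n →
  subst (λ m → Σ (Fin m → AbelianGroup.Carrier Γ) λ ψ → Σ (Matroid m) λ M → 2 ^ (n / 4) ≤ queries (A m ψ) M)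
        (size-blocks-divMod n)
        (hard-instance Γ A solves infinite (n / 4) (n % 4) (m≥n⇒m/n>0 4≤n))
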